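{- Let $\Gamma$ be a strongly regular graph of type II with parameters $(v,k,\lambda,\mu)$ and restricted eigenvalues $\rho>\sigma$, let $d$ be an integer with $0\le d<k$, and let $h_d=v\frac{d-\sigma}{k-\sigma}$. Then $[x_{\lfloor h_d\rfloor}]=[x_{h_d}]$ if and only if $$\mathrm{frac}(h_d)<\frac{v(k-d)}{(k-\sigma)(k-\sigma-1)}.$$
   Context: A graph is strongly regular with parameters $(v,k,\lambda,\mu)$ if it has $v$ vertices, is $k$-regular, is neither complete nor edgeless, every two adjacent vertices have exactly $\lambda$ common neighbours, and every two distinct non-adjacent vertices have exactly $\mu$ common neighbours. Its restricted eigenvalues $\rho>\sigma$ are the roots of $t^2-(\lambda-\mu)t-(k-\mu)=0$; it is of type II if all its eigenvalues are integers. For $y<v$ (and fixed $d$), $x_y=\frac{2y(k-d)-(v-y)}{2(v-y)}$. For real $x$, $[x]=\lceil x-1/2\rceil$ and $\mathrm{frac}(x)=x-\lfloor x\rfloor$. -}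

module Defs where

open import Data.Bool using (Bool; true; false; if_then_else_; not; _∧_)
open import Data.Nat as ℕ using (ℕ; zero; suc)
open import Data.Fin using (Fin; zero; suc)
open import Data.Integer as ℤ using (ℤ)
open import Data.Rational as ℚ using (ℚ; 0ℚ; ½; _-_; _+_; _*_; floor; ceiling; _≟_)
open import Data.Product using (_×_; ∃)
open import Relation.Nullary using (¬_; yes; no)
open import Relation.Binary.PropositionalEquality using (_≡_; _≢_)

count : ∀ {n} → (Fin n → Bool) → ℕ
count {zero} p = 0
count {suc n} p = (if p zero then 1 else 0) ℕ.+ count (λ i → p (suc i))

record Graph (v : ℕ) : Set where
  field
    adj       : Fin v → Fin v → Bool
    adj-sym   : ∀ i j → adj i j ≡ adj j i
    adj-irrefl : ∀ i → adj i i ≡ false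

open Graph public

common : ∀ {v} → Graph v → Fin v → Fin v → ℕ
common G i j = count (λ w → adj G i w ∧ adj G j w)

degree : ∀ {v} → Graph v → Fin v → ℕ
degree G i = count (adj G i)

record IsSRG {v : ℕ} (G : Graph v) (k lam mu : ℕ) : Set where
  field
    regular      : ∀ i → degree G i ≡ k
    adjacent     : ∀ i j → adj G i j ≡ true → common G i j ≡ lam
    nonadjacent  : ∀ i j → i ≢ j → adj G i j ≡ false → common G i j ≡ mu
    not-complete : ∃ λ i → ∃ λ j → i ≢ j × adj G i j ≡ false
    not-edgeless : ∃ λ i → ∃ λ j → adj G i j ≡ true

IsRestrictedRoot : (k lam mu : ℕ) → ℤ → Set
IsRestrictedRoot k lam mu θ =
  θ ℤ.* θ ℤ.- (ℤ.+ lam ℤ.- ℤ.+ mu) ℤ.* θ ℤ.- (ℤ.+ k ℤ.- ℤ.+ mu) ≡ ℤ.0ℤ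

zq : ℤ → ℚ
zq z = z ℚ./ 1

nq : ℕ → ℚ
nq n = zq (ℤ.+ n)

-- total division on ℚ (x / 0 := 0); only ever used with nonzero denominators
infixl 7 _÷'_
_÷'_ : ℚ → ℚ → ℚ
p ÷' q with q ≟ 0ℚ
... | yes _ = 0ℚ
... | no q≢0 = ℚ._÷_ p q {{ℚ.≢-nonZero q≢0}}

xval : (v k d : ℕ) → ℚ → ℚ
xval v k d y =
  (2ℚ * y * (nq k - nq d) - (nq v - y)) ÷' (2ℚ * (nq v - y))
  where 2ℚ = nq 2

round' : ℚ → ℤ
round' x = ceiling (x - ½)

frac : ℚ → ℚ
frac x = x - (zq (floor x))

hval : (v k d : ℕ) (σ : ℤ) → ℚ
hval v k d σ = (nq v * (nq d - zq σ)) ÷' (nq k - zq σ)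

{-# OPTIONS --safe #-}

-- Put K = k − σ. Since h = h_d solves h K = v (d − σ), clearing denominators gives, for t < v,
--   x_t − ½ = (d − σ − 1) − K (h − t) / (v − t).
-- At t = h the correction vanishes, so [x_h] = d − σ − 1; at t = ⌊h⌋ it is nonnegative, so
-- [x_⌊h⌋] = d − σ − 1 iff K frac(h) < (v − h) + frac(h), and as (v − h) K = v (k − d) this is
-- the stated bound on frac(h). The graph only enters through σ < 0, which makes K > 1:
-- by Vieta ρ + σ + ρσ = λ − k ≤ 0, impossible when ρ > σ ≥ 0.
module Submission where

open import Defs
open import Data.Bool using (Bool; true; false; _∧_)
open import Data.Empty using (⊥-elim)
open import Data.Fin as Fin using (Fin)
open import Data.Nat as ℕ using (ℕ; _≤_; _<_)
import Data.Nat.Properties as ℕ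
open import Data.Integer using (ℤ)
import Data.Integer as ℤ
import Data.Integer.Properties as ℤ
import Data.Integer.DivMod as ℤ
open import Data.Integer.GCD using (gcd-zeroʳ)
open import Data.Integer.Solver using (module +-*-Solver)
open import Data.Rational as ℚ
  using (ℚ; ↥_; ↧_; 0ℚ; 1ℚ; ½; _+_; _-_; _*_; -_; floor; ceiling; toℚᵘ; *≤*; *<*)
import Data.Rational.Properties as ℚ
import Data.Rational.Solver as ℚ-Solver
import Data.Rational.Unnormalised as ℚᵘ
import Data.Rational.Unnormalised.Properties as ℚᵘ
open import Data.Product using (_×_; _,_; proj₂)
open import Data.Product.Function.NonDependent.Propositional using (_×-⇔_)
open import Data.Sum using ([_,_]′)
open import Function using (id)
open import Function.Bundles using (_⇔_; mk⇔; Equivalence)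
open import Function.Properties.Equivalence using (⇔-setoid) renaming (sym to ⇔-sym)
open import Level using (0ℓ)
open import Relation.Binary.PropositionalEquality
open import Relation.Nullary using (yes; no)
open import Relation.Binary.Reasoning.Setoid (⇔-setoid 0ℓ) as ⇔-Reasoning using ()

module ℚR = ℚ-Solver.+-*-Solver

↥-zq : ∀ z → ↥ zq z ≡ z
↥-zq z = trans (sym (ℤ.*-identityʳ _)) (trans (cong (↥ zq z ℤ.*_) (sym (gcd-zeroʳ z))) (ℚ.↥-/ z 1))

↧-zq : ∀ z → ↧ zq z ≡ ℤ.1ℤ
↧-zq z = trans (sym (ℤ.*-identityʳ _)) (trans (cong (↧ zq z ℤ.*_) (sym (gcd-zeroʳ z))) (ℚ.↧-/ z 1))

i*↧zq≡i : ∀ i a → i ℤ.* ↧ zq a ≡ i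
i*↧zq≡i i a = trans (cong (i ℤ.*_) (↧-zq a)) (ℤ.*-identityʳ i)

↥zq*↧zq≡ : ∀ a b → ↥ zq a ℤ.* ↧ zq b ≡ a
↥zq*↧zq≡ a b = trans (cong (ℤ._* ↧ zq b) (↥-zq a)) (i*↧zq≡i a b)

zq≤⇔ : ∀ {a p} → zq a ℚ.≤ p ⇔ a ℤ.* ↧ p ℤ.≤ ↥ p
zq≤⇔ {a} {p} = mk⇔
  (λ a≤p → subst₂ ℤ._≤_ (cong (ℤ._* ↧ p) (↥-zq a)) (i*↧zq≡i (↥ p) a) (ℚ.drop-*≤* a≤p))
  (λ a≤p → *≤* (subst₂ ℤ._≤_ (cong (ℤ._* ↧ p) (sym (↥-zq a))) (sym (i*↧zq≡i (↥ p) a)) a≤p))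

<zq⇔ : ∀ {a p} → p ℚ.< zq a ⇔ ↥ p ℤ.< a ℤ.* ↧ p
<zq⇔ {a} {p} = mk⇔
  (λ p<a → subst₂ ℤ._<_ (i*↧zq≡i (↥ p) a) (cong (ℤ._* ↧ p) (↥-zq a)) (ℚ.drop-*<* p<a))
  (λ p<a → *<* (subst₂ ℤ._<_ (sym (i*↧zq≡i (↥ p) a)) (cong (ℤ._* ↧ p) (sym (↥-zq a))) p<a))

zq-mono-< : ∀ {a b} → a ℤ.< b → zq a ℚ.< zq b
zq-mono-< {a} {b} a<b = *<* (subst₂ ℤ._<_ (sym (↥zq*↧zq≡ a b)) (sym (↥zq*↧zq≡ b a)) a<b)

zq-cancel-< : ∀ {a b} → zq a ℚ.< zq b → a ℤ.< b
zq-cancel-< {a} {b} a<b = subst₂ ℤ._<_ (↥zq*↧zq≡ a b) (↥zq*↧zq≡ b a) (ℚ.drop-*<* a<b)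

0<1 : 0ℚ ℚ.< 1ℚ
0<1 = zq-mono-< {ℤ.+ 0} {ℤ.+ 1} (ℤ.+<+ (ℕ.s≤s ℕ.z≤n))

0<2 : 0ℚ ℚ.< nq 2
0<2 = zq-mono-< {ℤ.+ 0} {ℤ.+ 2} (ℤ.+<+ (ℕ.s≤s ℕ.z≤n))

toℚᵘ-zq : ∀ z → toℚᵘ (zq z) ℚᵘ.≃ ℚᵘ.mkℚᵘ z 0
toℚᵘ-zq z = ℚ.toℚᵘ-fromℚᵘ (ℚᵘ.mkℚᵘ z 0)

zq-homo-+ : ∀ a b → zq (a ℤ.+ b) ≡ zq a + zq b
zq-homo-+ a b = ℚ.toℚᵘ-injective (begin
  toℚᵘ (zq (a ℤ.+ b))                  ≈⟨ toℚᵘ-zq (a ℤ.+ b) ⟩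
  ℚᵘ.mkℚᵘ (a ℤ.+ b) 0                  ≈⟨ ℚᵘ.*≡* (solve 2 (λ x y → (x :+ y) :* con ℤ.1ℤ
                                                := (x :* con ℤ.1ℤ :+ y :* con ℤ.1ℤ) :* con ℤ.1ℤ) refl a b) ⟩
  ℚᵘ.mkℚᵘ a 0 ℚᵘ.+ ℚᵘ.mkℚᵘ b 0         ≈⟨ ℚᵘ.+-cong (toℚᵘ-zq a) (toℚᵘ-zq b) ⟨
  toℚᵘ (zq a) ℚᵘ.+ toℚᵘ (zq b)         ≈⟨ ℚ.toℚᵘ-homo-+ (zq a) (zq b) ⟨
  toℚᵘ (zq a + zq b)                   ∎)
  where open ℚᵘ.≃-Reasoning; open +-*-Solver

zq-homo‿- : ∀ a → zq (ℤ.- a) ≡ - zq a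
zq-homo‿- a = ℚ.toℚᵘ-injective (begin
  toℚᵘ (zq (ℤ.- a))     ≈⟨ toℚᵘ-zq (ℤ.- a) ⟩
  ℚᵘ.mkℚᵘ (ℤ.- a) 0     ≈⟨ ℚᵘ.-‿cong (toℚᵘ-zq a) ⟨
  ℚᵘ.- toℚᵘ (zq a)      ≈⟨ ℚ.toℚᵘ-homo‿- (zq a) ⟨
  toℚᵘ (- zq a)         ∎)
  where open ℚᵘ.≃-Reasoning

zq-homo-− : ∀ a b → zq (a ℤ.- b) ≡ zq a - zq b
zq-homo-− a b = trans (zq-homo-+ a (ℤ.- b)) (cong (λ t → zq a + t) (zq-homo‿- b))

zq-suc : ∀ a → zq (ℤ.suc a) ≡ 1ℚ + zq a
zq-suc a = zq-homo-+ (ℤ.+ 1) a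

neg-involutive : ∀ p → - (- p) ≡ p
neg-involutive = ℚR.solve 1 (λ p → ℚR.:- (ℚR.:- p) ℚR.:= p) refl

-p≤-q⇔q≤p : ∀ {p q} → - p ℚ.≤ - q ⇔ q ℚ.≤ p
-p≤-q⇔q≤p {p} {q} = mk⇔
  (λ -p≤-q → subst₂ ℚ._≤_ (neg-involutive q) (neg-involutive p) (ℚ.neg-antimono-≤ -p≤-q))
  ℚ.neg-antimono-≤

-p<-q⇔q<p : ∀ {p q} → - p ℚ.< - q ⇔ q ℚ.< p
-p<-q⇔q<p {p} {q} = mk⇔
  (λ -p<-q → subst₂ ℚ._<_ (neg-involutive q) (neg-involutive p) (ℚ.neg-antimono-< -p<-q))
  ℚ.neg-antimono-<

p<q⇔p+r<q+r : ∀ r {p q} → p ℚ.< q ⇔ p + r ℚ.< q + r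
p<q⇔p+r<q+r r {p} {q} = mk⇔ (ℚ.+-monoˡ-< r)
  (λ p+r<q+r → subst₂ ℚ._<_ (+-cancelʳ p) (+-cancelʳ q) (ℚ.+-monoˡ-< (- r) p+r<q+r))
  where
  +-cancelʳ : ∀ t → t + r + - r ≡ t
  +-cancelʳ t = ℚR.solve 2 (λ t r → t ℚR.:+ r ℚR.:+ ℚR.:- r ℚR.:= t) refl t r

p-q<p-r⇔r<q : ∀ {p q r} → p - q ℚ.< p - r ⇔ r ℚ.< q
p-q<p-r⇔r<q {p} {q} {r} = begin
  p - q ℚ.< p - r                              ≈⟨ p<q⇔p+r<q+r (q + r - p) ⟩
  p - q + (q + r - p) ℚ.< p - r + (q + r - p)  ≡⟨ cong₂ ℚ._<_ (solve 3 (λ p q r → p :- q :+ (q :+ r :- p) := r) refl p q r)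
                                                       (solve 3 (λ p q r → p :- r :+ (q :+ r :- p) := q) refl p q r) ⟩
  r ℚ.< q                                      ∎
  where
  open ⇔-Reasoning; open ℚR

p-q≤p : ∀ p {q} → 0ℚ ℚ.≤ q → p - q ℚ.≤ p
p-q≤p p 0≤q = subst (p - _ ℚ.≤_) (ℚ.+-identityʳ p) (ℚ.+-monoʳ-≤ p (ℚ.neg-antimono-≤ 0≤q))

p≤q⇒0≤q-p : ∀ {p q} → p ℚ.≤ q → 0ℚ ℚ.≤ q - p
p≤q⇒0≤q-p {p} {q} p≤q = subst (ℚ._≤ q - p) (ℚ.+-inverseʳ p) (ℚ.+-monoˡ-≤ (- p) p≤q)

p<q⇒0<q-p : ∀ {p q} → p ℚ.< q → 0ℚ ℚ.< q - p
p<q⇒0<q-p {p} {q} p<q = subst (ℚ._< q - p) (ℚ.+-inverseʳ p) (ℚ.+-monoˡ-< (- p) p<q)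

p<q⇔p*r<q*r : ∀ {p q r} → 0ℚ ℚ.< r → p ℚ.< q ⇔ p * r ℚ.< q * r
p<q⇔p*r<q*r {r = r} 0<r = mk⇔ (ℚ.*-monoˡ-<-pos r) (ℚ.*-cancelʳ-<-nonNeg r {{ℚ.pos⇒nonNeg r}})
  where instance _ = ℚ.positive 0<r

*-pos : ∀ {p q} → 0ℚ ℚ.< p → 0ℚ ℚ.< q → 0ℚ ℚ.< p * q
*-pos {p} {q} 0<p 0<q = subst (ℚ._< p * q) (ℚ.*-zeroˡ q) (Equivalence.to (p<q⇔p*r<q*r 0<q) 0<p)

*-nonNeg : ∀ {p q} → 0ℚ ℚ.≤ p → 0ℚ ℚ.≤ q → 0ℚ ℚ.≤ p * q
*-nonNeg {p} {q} 0≤p 0≤q = ℚ.nonNegative⁻¹ (p * q)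
  {{ℚ.nonNeg*nonNeg⇒nonNeg p {{ℚ.nonNegative 0≤p}} q {{ℚ.nonNegative 0≤q}}}}

0<q⇒q≢0 : ∀ {q} → 0ℚ ℚ.< q → q ≢ 0ℚ
0<q⇒q≢0 0<q q≡0 = ℚ.<-irrefl (sym q≡0) 0<q

÷'-*-cancel : ∀ p {q} → q ≢ 0ℚ → (p ÷' q) * q ≡ p
÷'-*-cancel p {q} q≢0 with q ℚ.≟ 0ℚ
... | yes q≡0 = ⊥-elim (q≢0 q≡0)
... | no q≢0' = begin
  p * ℚ.1/ q * q    ≡⟨ ℚ.*-assoc p (ℚ.1/ q) q ⟩
  p * (ℚ.1/ q * q)  ≡⟨ cong (p *_) (ℚ.*-inverseˡ q) ⟩
  p * 1ℚ            ≡⟨ ℚ.*-identityʳ p ⟩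
  p                 ∎
  where open ≡-Reasoning; instance _ = ℚ.≢-nonZero q≢0'

÷'-unique : ∀ {p q r} → q ≢ 0ℚ → r * q ≡ p → p ÷' q ≡ r
÷'-unique {p} {q} {r} q≢0 refl with q ℚ.≟ 0ℚ
... | yes q≡0 = ⊥-elim (q≢0 q≡0)
... | no q≢0' = begin
  r * q * ℚ.1/ q    ≡⟨ ℚ.*-assoc r q (ℚ.1/ q) ⟩
  r * (q * ℚ.1/ q)  ≡⟨ cong (r *_) (ℚ.*-inverseʳ q) ⟩
  r * 1ℚ            ≡⟨ ℚ.*-identityʳ r ⟩
  r                 ∎
  where open ≡-Reasoning; instance _ = ℚ.≢-nonZero q≢0'

p÷'q<r⇔p<r*q : ∀ {p q r} → 0ℚ ℚ.< q → p ÷' q ℚ.< r ⇔ p ℚ.< r * q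
p÷'q<r⇔p<r*q {p} {q} {r} 0<q = begin
  p ÷' q ℚ.< r           ≈⟨ p<q⇔p*r<q*r 0<q ⟩
  (p ÷' q) * q ℚ.< r * q  ≡⟨ cong (ℚ._< r * q) (÷'-*-cancel p (0<q⇒q≢0 0<q)) ⟩
  p ℚ.< r * q             ∎
  where open ⇔-Reasoning

r<p÷'q⇔r*q<p : ∀ {p q r} → 0ℚ ℚ.< q → r ℚ.< p ÷' q ⇔ r * q ℚ.< p
r<p÷'q⇔r*q<p {p} {q} {r} 0<q = begin
  r ℚ.< p ÷' q            ≈⟨ p<q⇔p*r<q*r 0<q ⟩
  r * q ℚ.< (p ÷' q) * q  ≡⟨ cong (r * q ℚ.<_) (÷'-*-cancel p (0<q⇒q≢0 0<q)) ⟩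
  r * q ℚ.< p             ∎
  where open ⇔-Reasoning

÷'-nonNeg : ∀ {p q} → 0ℚ ℚ.≤ p → 0ℚ ℚ.< q → 0ℚ ℚ.≤ p ÷' q
÷'-nonNeg {p} {q} 0≤p 0<q = ℚ.*-cancelʳ-≤-pos q {{ℚ.positive 0<q}}
  (subst₂ ℚ._≤_ (sym (ℚ.*-zeroˡ q)) (sym (÷'-*-cancel p (0<q⇒q≢0 0<q))) 0≤p)

i<j+1⇒i≤j : ∀ {i j} → i ℤ.< ℤ.suc j → i ℤ.≤ j
i<j+1⇒i≤j {i} {j} i<j+1 = subst (i ℤ.≤_) (ℤ.pred-suc j) (ℤ.i<j⇒i≤pred[j] i<j+1)

⌊p⌋≤p : ∀ p → zq (floor p) ℚ.≤ p
⌊p⌋≤p p@record{} = Equivalence.from (zq≤⇔ {floor p} {p})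
  (subst (floor p ℤ.* ↧ p ℤ.≤_) (sym (ℤ.a≡a%n+[a/n]*n (↥ p) (↧ p)))
         (ℤ.i≤j+i (floor p ℤ.* ↧ p) (ℤ.+ (↥ p ℤ.% ↧ p))))

p<⌊p⌋+1 : ∀ p → p ℚ.< zq (ℤ.suc (floor p))
p<⌊p⌋+1 p@record{} = Equivalence.from (<zq⇔ {ℤ.suc (floor p)} {p})
  (subst₂ ℤ._<_ (sym (ℤ.a≡a%n+[a/n]*n (↥ p) (↧ p))) (sym (ℤ.suc-* (floor p) (↧ p)))
          (ℤ.+-monoˡ-< (floor p ℤ.* ↧ p) (ℤ.+<+ (ℤ.n%d<d (↥ p) (↧ p)))))

floor≡⇔ : ∀ {p m} → floor p ≡ m ⇔ (zq m ℚ.≤ p × p ℚ.< zq (ℤ.suc m))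
floor≡⇔ {p} {m} = mk⇔ (λ { refl → ⌊p⌋≤p p , p<⌊p⌋+1 p })
  λ (m≤p , p<m+1) → ℤ.≤-antisym
    (i<j+1⇒i≤j (zq-cancel-< (ℚ.≤-<-trans (⌊p⌋≤p p) p<m+1)))
    (i<j+1⇒i≤j (zq-cancel-< (ℚ.≤-<-trans m≤p (p<⌊p⌋+1 p))))

⌈p⌉≡-⌊-p⌋ : ∀ p → ceiling p ≡ ℤ.- floor (- p)
⌈p⌉≡-⌊-p⌋ record{} = refl

-i≡j⇔i≡-j : ∀ {a b} → ℤ.- a ≡ b ⇔ a ≡ ℤ.- b
-i≡j⇔i≡-j {a} {b} = mk⇔ (λ { refl → sym (ℤ.neg-involutive a) }) (λ { refl → ℤ.neg-involutive b })

ceiling≡⇔ : ∀ {p m} → ceiling p ≡ m ⇔ (p ℚ.≤ zq m × zq m - 1ℚ ℚ.< p)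
ceiling≡⇔ {p} {m} = begin
  ceiling p ≡ m                                      ≡⟨ cong (_≡ m) (⌈p⌉≡-⌊-p⌋ p) ⟩
  ℤ.- floor (- p) ≡ m                                ≈⟨ -i≡j⇔i≡-j ⟩
  floor (- p) ≡ ℤ.- m                                ≈⟨ floor≡⇔ ⟩
  (zq (ℤ.- m) ℚ.≤ - p × - p ℚ.< zq (ℤ.suc (ℤ.- m)))  ≡⟨ cong₂ _×_ (cong (ℚ._≤ - p) (zq-homo‿- m)) (cong (- p ℚ.<_) -[m-1]) ⟩
  (- zq m ℚ.≤ - p × - p ℚ.< - (zq m - 1ℚ))           ≈⟨ -p≤-q⇔q≤p ×-⇔ -p<-q⇔q<p ⟩
  (p ℚ.≤ zq m × zq m - 1ℚ ℚ.< p)                     ∎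
  where
  open ⇔-Reasoning
  -[m-1] : zq (ℤ.suc (ℤ.- m)) ≡ - (zq m - 1ℚ)
  -[m-1] = trans (zq-suc (ℤ.- m)) (trans (cong (1ℚ +_) (zq-homo‿- m))
             (ℚR.solve 1 (λ x → ℚR.con 1ℚ ℚR.:+ ℚR.:- x ℚR.:= ℚR.:- (x ℚR.:- ℚR.con 1ℚ)) refl (zq m)))

⌈m-q⌉≡m⇔q<1 : ∀ m {q} → 0ℚ ℚ.≤ q → ceiling (zq m - q) ≡ m ⇔ q ℚ.< 1ℚ
⌈m-q⌉≡m⇔q<1 m 0≤q = mk⇔
  (λ ⌈m-q⌉≡m → Equivalence.to (p-q<p-r⇔r<q {zq m}) (proj₂ (Equivalence.to ceiling≡⇔ ⌈m-q⌉≡m)))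
  (λ q<1 → Equivalence.from ceiling≡⇔ (p-q≤p (zq m) 0≤q , Equivalence.from (p-q<p-r⇔r<q {zq m}) q<1))

-- The rounding criterion

xval-½≡ : ∀ v k d {s h t} → 0ℚ ℚ.< nq v - t → h * (nq k - s) ≡ nq v * (nq d - s) →
  xval v k d t - ½ ≡ (nq d - s - 1ℚ) - (nq k - s) * (h - t) ÷' (nq v - t)
xval-½≡ v k d {s} {h} {t} 0<v-t hK = begin
  xval v k d t - ½    ≡⟨ cong (_- ½) (÷'-unique {r = N + ½ - r} (0<q⇒q≢0 (*-pos 0<2 0<v-t)) N+½-r-cross) ⟩
  N + ½ - r - ½       ≡⟨ solve 2 (λ N r → N :+ con ½ :- r :- con ½ := N :- r) refl N r ⟩
  N - r               ∎
  where
  open ≡-Reasoning; open ℚR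
  V K N r X : ℚ
  V = nq v
  K = nq k - s
  N = nq d - s - 1ℚ
  r = K * (h - t) ÷' (V - t)
  X = nq 2 * t * (nq k - nq d) - (V - t)
  N+½-r-cross : (N + ½ - r) * (nq 2 * (V - t)) ≡ X
  N+½-r-cross = begin
    (N + ½ - r) * (nq 2 * (V - t))
      ≡⟨ solve 7 (λ V k d s h t r →
           (d :- s :- con 1ℚ :+ con ½ :- r) :* (con (nq 2) :* (V :- t))
           := con (nq 2) :* t :* (k :- d) :- (V :- t)
              :+ con (nq 2) :* (V :* (d :- s) :- h :* (k :- s))
              :+ con (nq 2) :* ((k :- s) :* (h :- t) :- r :* (V :- t)))
           refl V (nq k) (nq d) s h t r ⟩
    X + nq 2 * (V * (nq d - s) - h * K) + nq 2 * (K * (h - t) - r * (V - t))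
      ≡⟨ cong₂ (λ a b → X + nq 2 * a + nq 2 * b)
           (trans (cong (λ x → V * (nq d - s) - x) hK) (ℚ.+-inverseʳ (V * (nq d - s))))
           (trans (cong (λ x → K * (h - t) - x) (÷'-*-cancel (K * (h - t)) (0<q⇒q≢0 0<v-t))) (ℚ.+-inverseʳ (K * (h - t)))) ⟩
    X + nq 2 * 0ℚ + nq 2 * 0ℚ
      ≡⟨ solve 1 (λ a → a :+ con (nq 2) :* con 0ℚ :+ con (nq 2) :* con 0ℚ := a) refl X ⟩
    X ∎

[v-h][k-s]≡v[k-d] : ∀ {v h k d s} → h * (k - s) ≡ v * (d - s) → (v - h) * (k - s) ≡ v * (k - d)
[v-h][k-s]≡v[k-d] {v} {h} {k} {d} {s} hK = begin
  (v - h) * (k - s)                             ≡⟨ solve 5 (λ v h k d s → (v :- h) :* (k :- s)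
                                                     := v :* (k :- d) :+ (v :* (d :- s) :- h :* (k :- s))) refl v h k d s ⟩
  v * (k - d) + (v * (d - s) - h * (k - s))     ≡⟨ cong (λ x → v * (k - d) + (v * (d - s) - x)) hK ⟩
  v * (k - d) + (v * (d - s) - v * (d - s))     ≡⟨ cong (v * (k - d) +_) (ℚ.+-inverseʳ (v * (d - s))) ⟩
  v * (k - d) + 0ℚ                              ≡⟨ ℚ.+-identityʳ (v * (k - d)) ⟩
  v * (k - d)                                   ∎
  where open ≡-Reasoning; open ℚR

round'-xval≡⇔ : ∀ v k d {s h t} (c : ℤ) → zq c ≡ nq d - s - 1ℚ → 0ℚ ℚ.≤ nq k - s →
  t ℚ.≤ h → 0ℚ ℚ.< nq v - t → h * (nq k - s) ≡ nq v * (nq d - s) →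
  round' (xval v k d t) ≡ c ⇔ (nq k - s) * (h - t) ÷' (nq v - t) ℚ.< 1ℚ
round'-xval≡⇔ v k d {s} {h} {t} c zc≡N 0≤K t≤h 0<v-t hK = begin
  round' (xval v k d t) ≡ c                                ≡⟨ cong (λ x → ceiling x ≡ c) xval-½≡c-r ⟩
  ceiling (zq c - (nq k - s) * (h - t) ÷' (nq v - t)) ≡ c  ≈⟨ ⌈m-q⌉≡m⇔q<1 c (÷'-nonNeg (*-nonNeg 0≤K (p≤q⇒0≤q-p t≤h)) 0<v-t) ⟩
  (nq k - s) * (h - t) ÷' (nq v - t) ℚ.< 1ℚ                ∎
  where
  open ⇔-Reasoning
  xval-½≡c-r : xval v k d t - ½ ≡ zq c - (nq k - s) * (h - t) ÷' (nq v - t)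
  xval-½≡c-r = trans (xval-½≡ v k d {h = h} 0<v-t hK) (cong (_- _) (sym zc≡N))

round'-xval-h≡ : ∀ v k d {s h} (c : ℤ) → zq c ≡ nq d - s - 1ℚ → 0ℚ ℚ.≤ nq k - s →
  0ℚ ℚ.< nq v - h → h * (nq k - s) ≡ nq v * (nq d - s) → round' (xval v k d h) ≡ c
round'-xval-h≡ v k d {s} {h} c zc≡N 0≤K 0<v-h hK =
  Equivalence.from (round'-xval≡⇔ v k d c zc≡N 0≤K ℚ.≤-refl 0<v-h hK) (subst (ℚ._< 1ℚ) (sym gap≡0) 0<1)
  where
  gap≡0 : (nq k - s) * (h - h) ÷' (nq v - h) ≡ 0ℚ
  gap≡0 = ÷'-unique (0<q⇒q≢0 0<v-h)
    (trans (ℚ.*-zeroˡ (nq v - h)) (sym (trans (cong ((nq k - s) *_) (ℚ.+-inverseʳ h)) (ℚ.*-zeroʳ (nq k - s)))))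

scaled-gap<1⇔ : ∀ {K v h y} → 1ℚ ℚ.< K → 0ℚ ℚ.< v - h → y ℚ.≤ h →
  K * (h - y) ÷' (v - y) ℚ.< 1ℚ ⇔ h - y ℚ.< ((v - h) * K) ÷' (K * (K - 1ℚ))
scaled-gap<1⇔ {K} {v} {h} {y} 1<K 0<v-h y≤h = begin
  K * δ ÷' (v - y) ℚ.< 1ℚ             ≡⟨ cong (λ w → K * δ ÷' w ℚ.< 1ℚ) (solve 3 (λ v h y → v :- y := (v :- h) :+ (h :- y)) refl v h y) ⟩
  K * δ ÷' (W + δ) ℚ.< 1ℚ             ≈⟨ p÷'q<r⇔p<r*q (ℚ.+-mono-<-≤ 0<v-h (p≤q⇒0≤q-p y≤h)) ⟩
  K * δ ℚ.< 1ℚ * (W + δ)              ≈⟨ p<q⇔p+r<q+r (- δ) ⟩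
  K * δ - δ ℚ.< 1ℚ * (W + δ) - δ      ≡⟨ cong₂ ℚ._<_ (solve 2 (λ K δ → K :* δ :- δ := (K :- con 1ℚ) :* δ) refl K δ)
                                                      (solve 2 (λ W δ → con 1ℚ :* (W :+ δ) :- δ := W) refl W δ) ⟩
  (K - 1ℚ) * δ ℚ.< W                  ≈⟨ p<q⇔p*r<q*r 0<K ⟩
  (K - 1ℚ) * δ * K ℚ.< W * K          ≡⟨ cong (ℚ._< W * K) (solve 2 (λ K δ → (K :- con 1ℚ) :* δ :* K := δ :* (K :* (K :- con 1ℚ))) refl K δ) ⟩
  δ * (K * (K - 1ℚ)) ℚ.< W * K        ≈⟨ ⇔-sym (r<p÷'q⇔r*q<p (*-pos 0<K (p<q⇒0<q-p 1<K))) ⟩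
  δ ℚ.< (W * K) ÷' (K * (K - 1ℚ))     ∎
  where
  open ⇔-Reasoning; open ℚR
  W δ : ℚ
  W = v - h
  δ = h - y
  0<K : 0ℚ ℚ.< K
  0<K = ℚ.<-trans 0<1 1<K

round'-xval-floor≡⇔ : ∀ v k d (σ : ℤ) → 0 < v → d < k → 1ℚ ℚ.< nq k - zq σ →
  (round' (xval v k d (zq (floor (hval v k d σ)))) ≡ round' (xval v k d (hval v k d σ)))
  ⇔ (frac (hval v k d σ) ℚ.< (nq v * (nq k - nq d)) ÷' ((nq k - zq σ) * (nq k - zq σ - 1ℚ)))
round'-xval-floor≡⇔ v k d σ 0<v d<k 1<K = begin
  round' (xval v k d y) ≡ round' (xval v k d h)  ≡⟨ cong (round' (xval v k d y) ≡_) (round'-xval-h≡ v k d c zc≡N 0≤K 0<V-h hK) ⟩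
  round' (xval v k d y) ≡ c                      ≈⟨ round'-xval≡⇔ v k d c zc≡N 0≤K y≤h 0<V-y hK ⟩
  K * (h - y) ÷' (V - y) ℚ.< 1ℚ                  ≈⟨ scaled-gap<1⇔ {v = V} 1<K 0<V-h y≤h ⟩
  h - y ℚ.< ((V - h) * K) ÷' (K * (K - 1ℚ))      ≡⟨ cong (λ w → h - y ℚ.< w ÷' (K * (K - 1ℚ))) [V-h]K≡VE ⟩
  frac h ℚ.< (V * E) ÷' (K * (K - 1ℚ))           ∎
  where
  open ⇔-Reasoning
  V E K h y : ℚ
  V = nq v
  E = nq k - nq d
  K = nq k - zq σ
  h = hval v k d σ
  y = zq (floor h)
  y≤h : y ℚ.≤ h
  y≤h = ⌊p⌋≤p h
  c : ℤ
  c = ℤ.+ d ℤ.- σ ℤ.- ℤ.1ℤ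
  zc≡N : zq c ≡ nq d - zq σ - 1ℚ
  zc≡N = trans (zq-homo-− (ℤ.+ d ℤ.- σ) ℤ.1ℤ) (cong (_- 1ℚ) (zq-homo-− (ℤ.+ d) σ))
  0<K : 0ℚ ℚ.< K
  0<K = ℚ.<-trans 0<1 1<K
  0≤K : 0ℚ ℚ.≤ K
  0≤K = ℚ.<⇒≤ 0<K
  hK : h * K ≡ V * (nq d - zq σ)
  hK = ÷'-*-cancel (V * (nq d - zq σ)) (0<q⇒q≢0 0<K)
  [V-h]K≡VE : (V - h) * K ≡ V * E
  [V-h]K≡VE = [v-h][k-s]≡v[k-d] {V} {h} {nq k} {nq d} hK
  0<V-h : 0ℚ ℚ.< V - h
  0<V-h = Equivalence.from (p<q⇔p*r<q*r 0<K) (subst₂ ℚ._<_ (sym (ℚ.*-zeroˡ K)) (sym [V-h]K≡VE)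
            (*-pos (zq-mono-< (ℤ.+<+ 0<v)) (p<q⇒0<q-p (zq-mono-< (ℤ.+<+ d<k)))))
  0<V-y : 0ℚ ℚ.< V - y
  0<V-y = ℚ.<-≤-trans 0<V-h (ℚ.+-monoʳ-≤ V (ℚ.neg-antimono-≤ y≤h))

-- Strongly regular graphs and their restricted eigenvalues

count-mono : ∀ {n} (p q : Fin n → Bool) → (∀ i → p i ≡ true → q i ≡ true) → count p ≤ count q
count-mono {ℕ.zero} p q p⇒q = ℕ.z≤n
count-mono {ℕ.suc n} p q p⇒q with p Fin.zero in p0 | q Fin.zero in q0
... | true  | true  = ℕ.s≤s (count-mono _ _ (λ i → p⇒q (Fin.suc i)))
... | true  | false with () ← trans (sym q0) (p⇒q Fin.zero p0)
... | false | true  = ℕ.m≤n⇒m≤1+n (count-mono _ _ (λ i → p⇒q (Fin.suc i)))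
... | false | false = count-mono _ _ (λ i → p⇒q (Fin.suc i))

∧-true⇒ˡ : ∀ a {b} → a ∧ b ≡ true → a ≡ true
∧-true⇒ˡ true _ = refl

SRG⇒λ≤k : ∀ {v} {G : Graph v} {k lam mu} → IsSRG G k lam mu → lam ≤ k
SRG⇒λ≤k {G = G} srg with IsSRG.not-edgeless srg
... | i , j , i~j = subst₂ _≤_ (IsSRG.adjacent srg i j i~j) (IsSRG.regular srg i)
                      (count-mono _ _ (λ w → ∧-true⇒ˡ (adj G i w)))

SRG⇒0<v : ∀ {v} {G : Graph v} {k lam mu} → IsSRG G k lam mu → 0 < v
SRG⇒0<v {ℕ.zero}  srg with () , _ ← IsSRG.not-edgeless srg
SRG⇒0<v {ℕ.suc v} srg = ℕ.s≤s ℕ.z≤n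

ρ+σ≡λ-μ : ∀ k lam mu {ρ σ} → IsRestrictedRoot k lam mu ρ → IsRestrictedRoot k lam mu σ → σ ≢ ρ →
  ρ ℤ.+ σ ≡ ℤ.+ lam ℤ.- ℤ.+ mu
ρ+σ≡λ-μ k lam mu {ρ} {σ} Rρ Rσ σ≢ρ =
  ℤ.i-j≡0⇒i≡j (ρ ℤ.+ σ) b ([ (λ ρ-σ≡0 → ⊥-elim (σ≢ρ (sym (ℤ.i-j≡0⇒i≡j ρ σ ρ-σ≡0)))) , id ]′
                            (ℤ.i*j≡0⇒i≡0∨j≡0 (ρ ℤ.- σ) [ρ-σ][ρ+σ-b]≡0))
  where
  open +-*-Solver
  b : ℤ
  b = ℤ.+ lam ℤ.- ℤ.+ mu
  [ρ-σ][ρ+σ-b]≡0 : (ρ ℤ.- σ) ℤ.* (ρ ℤ.+ σ ℤ.- b) ≡ ℤ.0ℤ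
  [ρ-σ][ρ+σ-b]≡0 = trans
    (solve 4 (λ r s b c → (r :- s) :* (r :+ s :- b) := (r :* r :- b :* r :- c) :- (s :* s :- b :* s :- c))
       refl ρ σ b (ℤ.+ k ℤ.- ℤ.+ mu))
    (cong₂ ℤ._-_ Rρ Rσ)

ρ+σ+ρσ≡λ-k : ∀ k lam mu {ρ σ} → IsRestrictedRoot k lam mu ρ → IsRestrictedRoot k lam mu σ → σ ≢ ρ →
  ρ ℤ.+ σ ℤ.+ ρ ℤ.* σ ≡ ℤ.+ lam ℤ.- ℤ.+ k
ρ+σ+ρσ≡λ-k k lam mu {ρ} {σ} Rρ Rσ σ≢ρ = begin
  ρ ℤ.+ σ ℤ.+ ρ ℤ.* σ
    ≡⟨ solve 5 (λ r s l k m → r :+ s :+ r :* s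
                  := (l :- k) :+ (s :+ con ℤ.1ℤ) :* (r :+ s :- (l :- m)) :- (s :* s :- (l :- m) :* s :- (k :- m)))
         refl ρ σ (ℤ.+ lam) (ℤ.+ k) (ℤ.+ mu) ⟩
  λ-k ℤ.+ (σ ℤ.+ ℤ.1ℤ) ℤ.* (ρ ℤ.+ σ ℤ.- λ-μ) ℤ.- (σ ℤ.* σ ℤ.- λ-μ ℤ.* σ ℤ.- (ℤ.+ k ℤ.- ℤ.+ mu))
    ≡⟨ cong₂ (λ x y → λ-k ℤ.+ (σ ℤ.+ ℤ.1ℤ) ℤ.* (x ℤ.- λ-μ) ℤ.- y) (ρ+σ≡λ-μ k lam mu Rρ Rσ σ≢ρ) Rσ ⟩
  λ-k ℤ.+ (σ ℤ.+ ℤ.1ℤ) ℤ.* (λ-μ ℤ.- λ-μ) ℤ.- ℤ.0ℤ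
    ≡⟨ solve 3 (λ a s b → a :+ (s :+ con ℤ.1ℤ) :* (b :- b) :- con ℤ.0ℤ := a) refl λ-k σ λ-μ ⟩
  λ-k ∎
  where
  open ≡-Reasoning; open +-*-Solver
  λ-k λ-μ : ℤ
  λ-k = ℤ.+ lam ℤ.- ℤ.+ k
  λ-μ = ℤ.+ lam ℤ.- ℤ.+ mu

σ<0 : ∀ k lam mu {ρ σ} → IsRestrictedRoot k lam mu ρ → IsRestrictedRoot k lam mu σ → σ ℤ.< ρ →
  lam ≤ k → σ ℤ.< ℤ.0ℤ
σ<0 _ _ _ {σ = ℤ.-[1+ _ ]} _ _ _ _ = ℤ.-<+
σ<0 k lam mu {ℤ.+ r} {ℤ.+ s} Rρ Rσ σ<ρ lam≤k = ⊥-elim (ℤ.<⇒≱ 0<ρ+σ+ρσ ρ+σ+ρσ≤0)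
  where
  0<ρ+σ+ρσ : ℤ.0ℤ ℤ.< ℤ.+ r ℤ.+ ℤ.+ s ℤ.+ ℤ.+ r ℤ.* ℤ.+ s
  0<ρ+σ+ρσ = ℤ.<-≤-trans (ℤ.≤-<-trans (ℤ.+≤+ ℕ.z≤n) σ<ρ)
               (ℤ.≤-trans (ℤ.i≤i+j (ℤ.+ r) (ℤ.+ s))
                 (subst (λ j → ℤ.+ r ℤ.+ ℤ.+ s ℤ.≤ ℤ.+ r ℤ.+ ℤ.+ s ℤ.+ j) (ℤ.pos-* r s) (ℤ.i≤i+j _ (ℤ.+ (r ℕ.* s)))))
  ρ+σ+ρσ≤0 : ℤ.+ r ℤ.+ ℤ.+ s ℤ.+ ℤ.+ r ℤ.* ℤ.+ s ℤ.≤ ℤ.0ℤ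
  ρ+σ+ρσ≤0 = subst (ℤ._≤ ℤ.0ℤ) (sym (ρ+σ+ρσ≡λ-k k lam mu Rρ Rσ (ℤ.<⇒≢ σ<ρ))) (ℤ.i≤j⇒i-j≤0 (ℤ.+≤+ lam≤k))

1<k-σ : ∀ {k σ} → 0 < k → σ ℤ.< ℤ.0ℤ → 1ℚ ℚ.< nq k - zq σ
1<k-σ {k} {σ} 0<k σ<0 = subst (1ℚ ℚ.<_) (zq-homo-− (ℤ.+ k) σ)
  (zq-mono-< (ℤ.+-mono-<-≤ (ℤ.+<+ 0<k) (ℤ.i<j⇒suc[i]≤j (ℤ.neg-mono-< σ<0))))

lemma6p10 : (v k lam mu : ℕ) (G : Graph v) → IsSRG G k lam mu →
  (ρ σ : ℤ) → IsRestrictedRoot k lam mu ρ → IsRestrictedRoot k lam mu σ →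
  σ Data.Integer.< ρ →
  (d : ℕ) → 0 ≤ d → d < k →
  (round' (xval v k d (zq (floor (hval v k d σ)))) ≡ round' (xval v k d (hval v k d σ)))
    ⇔ (frac (hval v k d σ) ℚ.< ((nq v * (nq k - nq d))
        ÷' ((nq k - zq σ) * (nq k - zq σ - nq 1))))
lemma6p10 v k lam mu G srg ρ σ Rρ Rσ σ<ρ d _ d<k =
  round'-xval-floor≡⇔ v k d σ (SRG⇒0<v srg) d<k
    (1<k-σ (ℕ.≤-<-trans ℕ.z≤n d<k) (σ<0 k lam mu Rρ Rσ σ<ρ (SRG⇒λ≤k srg)))
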